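{- Let $G=(V,E)$ be a graph with $V=\{1,\dots,n\}$ and $m$ edges. Suppose $G$ is given by both its adjacency lists $ADJ(v)$ and its adjacency matrix $M$, with vertex degrees available. Consider algorithm Hybrid: for each edge $ij\in E$ with $i<j$, let $x$ be the endpoint of smaller degree and $y$ the other one (set $x=i$, $y=j$ if $\deg(i)\le\deg(j)$, and $x=j$, $y=i$ otherwise). Then for each $k\in ADJ(x)$, if $j<k$ and $M(y,k)=1$, report the triangle $ijk$. This algorithm reports every triangle of $G$ exactly once and runs in $O(m\alpha)$ time, where $\alpha=\alpha(G)$ is the arboricity of $G$.
   Context: Graphs are finite, simple and undirected. The arboricity $\alpha(G)$ is the minimum number of edge-disjoint forests into which the edge set of $G$ can be partitioned. A triangle is a set of three pairwise adjacent vertices. -}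

module Defs where

open import Data.Nat using (ℕ; zero; suc; _+_; _*_; _≤_; _<_; _≤ᵇ_)
open import Data.Bool using (Bool; true; false; _∧_; if_then_else_)
open import Data.Fin using (Fin; _<?_; _≟_)
open import Data.List using (List; []; _∷_; length; map; concatMap; filterᵇ; allFin)
open import Data.List.Relation.Unary.Unique.Propositional using (Unique)
open import Data.List.Relation.Unary.All using (All)
open import Data.List.Membership.Propositional using (_∈_)
open import Data.Product using (_×_; _,_; Σ; ∃)
open import Data.Empty using (⊥)
import Data.Unit
import Data.Bool
import Data.List
import Data.Product
open import Relation.Nullary using (¬_)
open import Relation.Nullary.Decidable using (⌊_⌋)
open import Relation.Binary.PropositionalEquality using (_≡_)
open import Function.Bundles using (_⇔_)

-- A finite simple graph on vertex set Fin n (vertex v ↔ paper's v+1, same order),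
-- given simultaneously by its adjacency matrix M and adjacency lists ADJ.
record Graph (n : ℕ) : Set where
  field
    M           : Fin n → Fin n → Bool
    M-sym       : ∀ u v → M u v ≡ M v u
    M-irrefl    : ∀ v → M v v ≡ false
    ADJ         : Fin n → List (Fin n)
    ADJ-unique  : ∀ v → Unique (ADJ v)
    ADJ-correct : ∀ v w → (w ∈ ADJ v) ⇔ (M v w ≡ true)

module _ {n : ℕ} (G : Graph n) where
  open Graph G

  Adj : Fin n → Fin n → Set
  Adj u v = M u v ≡ true

  deg : Fin n → ℕ
  deg v = length (ADJ v)

  edgeList : List (Fin n × Fin n)
  edgeList = concatMap (λ i → map (λ j → (i , j))
                         (filterᵇ (λ j → ⌊ i <? j ⌋ ∧ M i j) (allFin n))) (allFin n)

  numEdges : ℕ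
  numEdges = length edgeList

  Triple : Set
  Triple = Fin n × Fin n × Fin n

  -- Returns (reported triangles, number of iterations = elementary steps).
  innerLoop : Fin n → Fin n → Fin n → List (Fin n) → List Triple × ℕ
  innerLoop i j y [] = [] , 0
  innerLoop i j y (k ∷ ks) with innerLoop i j y ks
  ... | out , c = (if ⌊ j <? k ⌋ ∧ M y k then (i , j , k) ∷ out else out) , suc c

  hybridEdge : Fin n × Fin n → List Triple × ℕ
  hybridEdge (i , j) =
    if deg i ≤ᵇ deg j then innerLoop i j j (ADJ i) else innerLoop i j i (ADJ j)

  -- Algorithm Hybrid: output list of reported triangles together with its
  -- running time (unit cost per edge processed plus per inner iteration;
  -- degree lookups and matrix probes are O(1)).
  hybridRun : List (Fin n × Fin n) → List Triple × ℕ
  hybridRun [] = [] , 0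
  hybridRun (e ∷ es) with hybridEdge e | hybridRun es
  ... | out₁ , c₁ | out₂ , c₂ = Data.List._++_ out₁ out₂ , suc (c₁ + c₂)

  hybridOutput : List Triple
  hybridOutput = Data.Product.proj₁ (hybridRun edgeList)

  hybridTime : ℕ
  hybridTime = Data.Product.proj₂ (hybridRun edgeList)

  -- three pairwise adjacent (hence distinct) vertices
  IsTriangle : Fin n → Fin n → Fin n → Set
  IsTriangle a b c = Adj a b × Adj a c × Adj b c

  memb : Fin n → Triple → Bool
  memb v (x , y , z) = ⌊ v ≟ x ⌋ Data.Bool.∨ ⌊ v ≟ y ⌋ Data.Bool.∨ ⌊ v ≟ z ⌋

  sameSet : Fin n → Fin n → Fin n → Triple → Bool
  sameSet a b c t@(x , y , z) =
    memb a t ∧ memb b t ∧ memb c t ∧ memb x (a , b , c) ∧ memb y (a , b , c) ∧ memb z (a , b , c)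

  timesReported : Fin n → Fin n → Fin n → ℕ
  timesReported a b c = length (filterᵇ (sameSet a b c) hybridOutput)

  Path : (Fin n → Fin n → Set) → List (Fin n) → Set
  Path R []             = Data.Unit.⊤
  Path R (v ∷ [])       = Data.Unit.⊤
  Path R (u ∷ v ∷ vs)   = R u v × Path R (v ∷ vs)

  lastOr : Fin n → List (Fin n) → Fin n
  lastOr d []       = d
  lastOr d (v ∷ vs) = lastOr v vs

  IsCycle : (Fin n → Fin n → Set) → List (Fin n) → Set
  IsCycle R [] = ⊥
  IsCycle R (v ∷ vs) = (3 ≤ length (v ∷ vs)) × Unique (v ∷ vs) × Path R (v ∷ vs) × R (lastOr v vs) v

  Acyclic : (Fin n → Fin n → Set) → Set
  Acyclic R = ∀ cyc → ¬ IsCycle R cyc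

  -- a partition of E into k edge-disjoint forests: a colouring of edges by Fin k
  -- whose every colour class is acyclic
  ForestPartition : ℕ → Set
  ForestPartition k =
    Σ (Fin n → Fin n → Fin k) λ col →
      (∀ u v → col u v ≡ col v u) ×
      (∀ (c : Fin k) → Acyclic (λ u v → Adj u v × col u v ≡ c))

  IsArboricity : ℕ → Set
  IsArboricity α = ForestPartition α × (∀ k → ForestPartition k → α ≤ k)

{-# OPTIONS --safe #-}

-- Every triple reported while processing the edge ij (i < j) is ijk with j < k and k adjacent
-- to both i and j; so only sorted triangles are reported, and the triangle a < b < c can only be
-- reported from the edge ab, exactly once, when the scan of the duplicate-free list ADJ(x)
-- meets c.  The work spent on ij is 1 + min(deg i, deg j).  In a forest F some vertex of every
-- vertex set S spanning an edge has at most one neighbour in S (a maximal simple path ends in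
-- one, as F has no cycle); deleting it loses only the weight min(deg ℓ, deg p) ≤ deg ℓ of
-- its edge ℓp, so by induction the sum of min(deg u, deg v) over ordered adjacent pairs of F
-- is at most twice the degree sum, 4m.  Summing over the α forests, the running time is at
-- most m + 4αm ≤ 5αm.
module Submission where

open import Defs
open import Data.Nat using (ℕ; zero; suc; _+_; _*_; _≤_; _<_; _⊓_; _≤ᵇ_; z≤n; s≤s)
open import Data.Nat.Properties
  using ( module ≤-Reasoning; +-0-commutativeMonoid; +-commutativeSemigroup; +-mono-≤; +-identityʳ; +-suc; +-comm; ≤-refl; ≤-trans; <⇒≱
        ; ≤-reflexive; ≤-antisym; <-trans; ≤-pred; +-monoʳ-≤; <⇒≤; ≰⇒>; ≤ᵇ⇒≤; ≤⇒≤ᵇ; m≤n⇒m⊓n≡m; m≥n⇒m⊓n≡n; m≤m*n; +-monoˡ-≤; m<m+n; m≤m+n; m⊓n≤m; m⊓n≤n; m≤n+m; *-identityʳ; +-assoc)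
open import Data.Bool using (Bool; true; false; T; _∧_; _∨_; not; if_then_else_)
import Data.Bool.Properties as Bool
open import Data.Bool.Properties using (T-≡; T-∧)
open import Data.Fin using (Fin; zero; suc; toℕ; _≟_; _<?_) renaming (_<_ to _<ᶠ_)
open import Data.Fin.Properties using (suc-injective; toℕ-injective; any?; <-cmp; <-irrefl; ¬Fin0)
open import Data.List using (List; []; _∷_; _++_; length; map; concatMap; filterᵇ; allFin; tabulate; take)
open import Data.List.Membership.Propositional using (_∈_)
open import Data.List.Relation.Unary.All as All using (All; []; _∷_)
open import Data.List.Relation.Unary.All.Properties using (¬Any⇒All¬; All¬⇒¬Any; map⁺; concat⁺; all-filter; filter⁺)
open import Data.List.Relation.Unary.Any using (here; there; index)
open import Data.List.Relation.Unary.AllPairs using ([]; _∷_)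
open import Data.List.Relation.Unary.Unique.Propositional using (Unique)
open import Data.List.Relation.Unary.Unique.Propositional.Properties using (take⁺)
open import Data.Product using (_×_; _,_; Σ; ∃; proj₁; proj₂)
open import Data.Sum using (_⊎_; inj₁; inj₂)
open import Data.Empty using (⊥-elim)
open import Data.Unit using (tt)
open import Relation.Binary.Definitions using (tri<; tri≈; tri>)
open import Function using (_∘_; case_of_)
open import Function.Bundles using (Equivalence)
open import Relation.Nullary using (¬_; Dec; yes; no; ¬?; _×-dec_)
open import Relation.Nullary.Decidable using (⌊_⌋; T?; isYes≗does; dec-true; dec-false)
open import Relation.Binary.PropositionalEquality
open import Data.Nat.Tactic.RingSolver using (solve-∀)
open import Algebra.Properties.CommutativeSemigroup +-commutativeSemigroup using ()
  renaming (interchange to +-interchange; x∙yz≈y∙xz to m+[n+o]≡n+[m+o])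
open import Algebra.Properties.CommutativeMonoid.Sum +-0-commutativeMonoid
  using (sum; sum-syntax; ∑-distrib-+; ∑-comm; sum-cong-≗; sum-replicate-zero)

⌊⌋-yes : ∀ {a} {A : Set a} (d : Dec A) → A → ⌊ d ⌋ ≡ true
⌊⌋-yes d a = trans (isYes≗does d) (dec-true d a)

⌊⌋-no : ∀ {a} {A : Set a} (d : Dec A) → ¬ A → ⌊ d ⌋ ≡ false
⌊⌋-no d ¬a = trans (isYes≗does d) (dec-false d ¬a)

⌊⌋-sound : ∀ {a} {A : Set a} (d : Dec A) → ⌊ d ⌋ ≡ true → A
⌊⌋-sound (yes a) _ = a

∧-trueˡ : ∀ {a b} → a ∧ b ≡ true → a ≡ true
∧-trueˡ {true} _ = refl

∧-trueʳ : ∀ {a b} → a ∧ b ≡ true → b ≡ true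
∧-trueʳ {true} b≡true = b≡true

∧-true⁶ : ∀ {p q r s u v} → p ∧ q ∧ r ∧ s ∧ u ∧ v ≡ true →
          p ≡ true × q ≡ true × r ≡ true × s ≡ true × u ≡ true × v ≡ true
∧-true⁶ {true} {true} {true} {true} {true} v≡true = refl , refl , refl , refl , refl , v≡true

∑-mono-≤ : ∀ {n} {f g : Fin n → ℕ} → (∀ i → f i ≤ g i) → sum f ≤ sum g
∑-mono-≤ {zero}  _   = z≤n
∑-mono-≤ {suc n} f≤g = +-mono-≤ (f≤g zero) (∑-mono-≤ (f≤g ∘ suc))

∑∑-distrib-+ : ∀ {m n} (f g : Fin m → Fin n → ℕ) →
               ∑[ i < m ] ∑[ j < n ] (f i j + g i j) ≡ ∑[ i < m ] ∑[ j < n ] f i j + ∑[ i < m ] ∑[ j < n ] g i j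
∑∑-distrib-+ {m} {n} f g =
  trans (sum-cong-≗ (λ i → ∑-distrib-+ {n} (f i) (g i))) (∑-distrib-+ {m} (sum ∘ f) (sum ∘ g))

∑-const : ∀ n (c : ℕ) → ∑[ i < n ] c ≡ n * c
∑-const zero    c = refl
∑-const (suc n) c = cong (c +_) (∑-const n c)

∑-point : ∀ {n} (f : Fin n → ℕ) (k : Fin n) → (∀ i → i ≢ k → f i ≡ 0) → sum f ≡ f k
∑-point {suc n} f zero    f≡0 =
  trans (cong (f zero +_) (trans (sum-cong-≗ (λ i → f≡0 (suc i) λ ())) (sum-replicate-zero n)))
        (+-identityʳ (f zero))
∑-point {suc n} f (suc k) f≡0 =
  trans (cong (_+ sum (f ∘ suc)) (f≡0 zero λ ()))
        (∑-point (f ∘ suc) k (λ i i≢k → f≡0 (suc i) (i≢k ∘ suc-injective)))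

∑-δ : ∀ {n} (k : Fin n) (c : ℕ) → ∑[ i < n ] (if ⌊ i ≟ k ⌋ then c else 0) ≡ c
∑-δ k c = trans (∑-point _ k (λ i i≢k → cong (if_then c else 0) (⌊⌋-no (i ≟ k) i≢k)))
                (cong (if_then c else 0) (⌊⌋-yes (k ≟ k) refl))

∑∑-δ : ∀ {n} (a b : Fin n) (c : ℕ) →
       ∑[ i < n ] ∑[ j < n ] (if ⌊ i ≟ a ⌋ ∧ ⌊ j ≟ b ⌋ then c else 0) ≡ c
∑∑-δ {n} a b c = trans (∑-point _ a off-a) (trans (cong (λ t → sum (λ j → if t ∧ ⌊ j ≟ b ⌋ then c else 0))
                                                    (⌊⌋-yes (a ≟ a) refl))
                                              (∑-δ b c))
  where
  off-a : ∀ i → i ≢ a → ∑[ j < n ] (if ⌊ i ≟ a ⌋ ∧ ⌊ j ≟ b ⌋ then c else 0) ≡ 0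
  off-a i i≢a rewrite ⌊⌋-no (i ≟ a) i≢a = sum-replicate-zero n

sumMap : ∀ {A : Set} → (A → ℕ) → List A → ℕ
sumMap f []       = 0
sumMap f (x ∷ xs) = f x + sumMap f xs

sumMap-cong : ∀ {A : Set} {f g : A → ℕ} → (∀ x → f x ≡ g x) → ∀ xs → sumMap f xs ≡ sumMap g xs
sumMap-cong f≗g []       = refl
sumMap-cong f≗g (x ∷ xs) = cong₂ _+_ (f≗g x) (sumMap-cong f≗g xs)

sumMap-++ : ∀ {A : Set} (f : A → ℕ) xs ys → sumMap f (xs ++ ys) ≡ sumMap f xs + sumMap f ys
sumMap-++ f []       ys = refl
sumMap-++ f (x ∷ xs) ys = trans (cong (f x +_) (sumMap-++ f xs ys)) (sym (+-assoc (f x) _ _))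

sumMap-map : ∀ {A B : Set} (f : B → ℕ) (g : A → B) xs → sumMap f (map g xs) ≡ sumMap (f ∘ g) xs
sumMap-map f g []       = refl
sumMap-map f g (x ∷ xs) = cong (f (g x) +_) (sumMap-map f g xs)

sumMap-concatMap : ∀ {A B : Set} (f : B → ℕ) (g : A → List B) xs →
                   sumMap f (concatMap g xs) ≡ sumMap (sumMap f ∘ g) xs
sumMap-concatMap f g []       = refl
sumMap-concatMap f g (x ∷ xs) =
  trans (sumMap-++ f (g x) (concatMap g xs)) (cong (sumMap f (g x) +_) (sumMap-concatMap f g xs))

sumMap-filterᵇ : ∀ {A : Set} (f : A → ℕ) (p : A → Bool) xs →
                 sumMap f (filterᵇ p xs) ≡ sumMap (λ x → if p x then f x else 0) xs
sumMap-filterᵇ f p []       = refl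
sumMap-filterᵇ f p (x ∷ xs) with p x
... | true  = cong (f x +_) (sumMap-filterᵇ f p xs)
... | false = sumMap-filterᵇ f p xs

sumMap-suc : ∀ {A : Set} (f : A → ℕ) xs → sumMap (suc ∘ f) xs ≡ length xs + sumMap f xs
sumMap-suc f []       = refl
sumMap-suc f (x ∷ xs) =
  cong suc (trans (cong (f x +_) (sumMap-suc f xs)) (m+[n+o]≡n+[m+o] (f x) (length xs) (sumMap f xs)))

length≡sumMap-1 : ∀ {A : Set} (xs : List A) → length xs ≡ sumMap (λ _ → 1) xs
length≡sumMap-1 []       = refl
length≡sumMap-1 (x ∷ xs) = cong suc (length≡sumMap-1 xs)

sumMap-tabulate : ∀ {A : Set} {n} (f : A → ℕ) (g : Fin n → A) → sumMap f (tabulate g) ≡ sum (f ∘ g)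
sumMap-tabulate {n = zero}  f g = refl
sumMap-tabulate {n = suc n} f g = cong (f (g zero) +_) (sumMap-tabulate f (g ∘ suc))

sumMap-allFin : ∀ {n} (f : Fin n → ℕ) → sumMap f (allFin n) ≡ sum f
sumMap-allFin f = sumMap-tabulate f (λ i → i)

module _ {n : ℕ} where

  open import Data.List.Membership.DecPropositional (_≟_ {n}) using (_∈?_)

  occ : Fin n → List (Fin n) → ℕ
  occ w = sumMap (λ x → if ⌊ w ≟ x ⌋ then 1 else 0)

  length≡∑occ : ∀ xs → length xs ≡ ∑[ w < n ] occ w xs
  length≡∑occ []       = sym (sum-replicate-zero n)
  length≡∑occ (x ∷ xs) = sym (begin
    ∑[ w < n ] ((if ⌊ w ≟ x ⌋ then 1 else 0) + occ w xs)            ≡⟨ ∑-distrib-+ {n} _ _ ⟩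
    ∑[ w < n ] (if ⌊ w ≟ x ⌋ then 1 else 0) + ∑[ w < n ] occ w xs  ≡⟨ cong₂ _+_ (∑-δ x 1) (sym (length≡∑occ xs)) ⟩
    suc (length xs)                                                ∎)
    where open ≡-Reasoning

  ∉⇒occ≡0 : ∀ {w} xs → ¬ w ∈ xs → occ w xs ≡ 0
  ∉⇒occ≡0 []       _   = refl
  ∉⇒occ≡0 {w} (x ∷ xs) w∉ rewrite ⌊⌋-no (w ≟ x) (w∉ ∘ here) = ∉⇒occ≡0 xs (w∉ ∘ there)

  Unique∧∈⇒occ≡1 : ∀ {w} xs → Unique xs → w ∈ xs → occ w xs ≡ 1
  Unique∧∈⇒occ≡1 {w} (x ∷ xs) (x∉xs ∷ _) (here refl)
    rewrite ⌊⌋-yes (w ≟ w) refl = cong suc (∉⇒occ≡0 xs (All¬⇒¬Any x∉xs))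
  Unique∧∈⇒occ≡1 {w} (x ∷ xs) (x∉xs ∷ u) (there w∈xs)
    rewrite ⌊⌋-no (w ≟ x) (λ { refl → All¬⇒¬Any x∉xs w∈xs }) = Unique∧∈⇒occ≡1 xs u w∈xs

  Unique⇒occ≤1 : ∀ w xs → Unique xs → occ w xs ≤ 1
  Unique⇒occ≤1 w xs u with w ∈? xs
  ... | yes w∈xs = ≤-reflexive (Unique∧∈⇒occ≡1 xs u w∈xs)
  ... | no  w∉xs = subst (_≤ 1) (sym (∉⇒occ≡0 xs w∉xs)) z≤n

  Unique⇒length≤n : ∀ xs → Unique xs → length xs ≤ n
  Unique⇒length≤n xs u = begin
    length xs                ≡⟨ length≡∑occ xs ⟩
    ∑[ w < n ] occ w xs      ≤⟨ ∑-mono-≤ (λ w → Unique⇒occ≤1 w xs u) ⟩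
    ∑[ w < n ] 1             ≡⟨ trans (∑-const n 1) (*-identityʳ n) ⟩
    n                        ∎
    where open ≤-Reasoning

module _ {n : ℕ} (G : Graph n) {R R′ : Fin n → Fin n → Set} (R⊆R′ : ∀ {u v} → R u v → R′ u v) where

  Path-mono : ∀ xs → Path G R xs → Path G R′ xs
  Path-mono []           _         = tt
  Path-mono (x ∷ [])     _         = tt
  Path-mono (x ∷ y ∷ xs) (xRy , p) = R⊆R′ xRy , Path-mono (y ∷ xs) p

  Acyclic-antimono : Acyclic G R′ → Acyclic G R
  Acyclic-antimono acyclic (x ∷ xs) (3≤len , u , p , closing) =
    acyclic (x ∷ xs) (3≤len , u , Path-mono (x ∷ xs) p , R⊆R′ closing)

module Forest {n : ℕ} (G : Graph n) (r : Fin n → Fin n → Bool)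
               (r-sym : ∀ u v → r u v ≡ r v u) (r-irrefl : ∀ v → r v v ≡ false)
               (r-acyclic : Acyclic G (λ u v → r u v ≡ true)) where

  open import Data.List.Membership.DecPropositional (_≟_ {n}) using (_∈?_)

  R : Fin n → Fin n → Set
  R u v = r u v ≡ true

  R-irrefl : ∀ {v} → ¬ R v v
  R-irrefl {v} vRv with () ← trans (sym (r-irrefl v)) vRv

  Path-take : ∀ k xs → Path G R xs → Path G R (take k xs)
  Path-take zero          xs           _         = tt
  Path-take (suc k)       []           _         = tt
  Path-take (suc zero)    (x ∷ xs)     _         = tt
  Path-take (suc (suc k)) (x ∷ [])     _         = tt
  Path-take (suc (suc k)) (x ∷ y ∷ xs) (xRy , p) = xRy , Path-take (suc k) (y ∷ xs) p

  lastOr-takeThrough : ∀ {q} d xs (q∈xs : q ∈ xs) → lastOr G d (take (suc (toℕ (index q∈xs))) xs) ≡ q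
  lastOr-takeThrough d (x ∷ xs) (here refl)  = refl
  lastOr-takeThrough d (x ∷ xs) (there q∈xs) = lastOr-takeThrough x xs q∈xs

  -- a simple path v w … q … together with an edge q v closes the cycle v w … q
  chord⇒cycle : ∀ {q} v w rest (q∈rest : q ∈ rest) → Unique (v ∷ w ∷ rest) → Path G R (v ∷ w ∷ rest) →
                R q v → IsCycle G R (take (3 + toℕ (index q∈rest)) (v ∷ w ∷ rest))
  chord⇒cycle v w rest@(_ ∷ _) q∈rest u p qRv =
      s≤s (s≤s (s≤s z≤n))
    , take⁺ (3 + toℕ (index q∈rest)) u
    , Path-take (3 + toℕ (index q∈rest)) (v ∷ w ∷ rest) p
    , subst (λ x → R x v) (sym (lastOr-takeThrough w rest q∈rest)) qRv

  record AtMostOneNeighbourIn (S : Fin n → Bool) : Set where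
    field
      vertex           : Fin n
      vertex∈S         : S vertex ≡ true
      neighbour        : Fin n
      neighbour-unique : ∀ q → S q ≡ true → R vertex q → q ≡ neighbour

  module _ (S : Fin n → Bool) where

    -- The simple path v w rest is extended at its head v until v has no neighbour in S other
    -- than w; it cannot grow beyond n vertices, and a neighbour already on it closes a cycle.
    walk : (fuel : ℕ) (v w : Fin n) (rest : List (Fin n)) → n < fuel + length (v ∷ w ∷ rest) →
           Unique (v ∷ w ∷ rest) → Path G R (v ∷ w ∷ rest) → S v ≡ true → AtMostOneNeighbourIn S
    walk zero v w rest n<len u _ _ = ⊥-elim (<⇒≱ n<len (Unique⇒length≤n (v ∷ w ∷ rest) u))
    walk (suc fuel) v w rest n<len u p v∈S
      with any? (λ q → (S q Bool.≟ true) ×-dec (r v q Bool.≟ true) ×-dec ¬? (q ≟ w))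
    ... | no none = record { vertex = v ; vertex∈S = v∈S ; neighbour = w ; neighbour-unique = unique }
      where
      unique : ∀ q → S q ≡ true → R v q → q ≡ w
      unique q q∈S vRq with q ≟ w
      ... | yes q≡w = q≡w
      ... | no  q≢w = ⊥-elim (none (q , q∈S , vRq , q≢w))
    ... | yes (q , q∈S , vRq , q≢w) with q ∈? (v ∷ w ∷ rest)
    ...   | yes (here refl)          = ⊥-elim (R-irrefl vRq)
    ...   | yes (there (here q≡w))   = ⊥-elim (q≢w q≡w)
    ...   | yes (there (there q∈rest)) =
              ⊥-elim (r-acyclic _ (chord⇒cycle v w rest q∈rest u p (trans (r-sym q v) vRq)))
    ...   | no q∉path =
              walk fuel q v (w ∷ rest) (subst (n <_) (sym (+-suc fuel _)) n<len)
                   (¬Any⇒All¬ _ q∉path ∷ u) (trans (r-sym q v) vRq , p) q∈S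

    atMostOneNeighbour-exists : ∀ {v w} → S v ≡ true → R v w → AtMostOneNeighbourIn S
    atMostOneNeighbour-exists {v} {w} v∈S vRw =
      walk n v w [] (m<m+n n (s≤s z≤n)) ((v≢w ∷ []) ∷ [] ∷ []) (vRw , tt) v∈S
      where
      v≢w : v ≢ w
      v≢w refl = R-irrefl vRw

  remove : (Fin n → Bool) → Fin n → Fin n → Bool
  remove S ℓ i = S i ∧ not ⌊ i ≟ ℓ ⌋

  sumOn : (Fin n → Bool) → (Fin n → ℕ) → ℕ
  sumOn S h = ∑[ i < n ] (if S i then h i else 0)

  sumOn-remove : ∀ S {ℓ} h → S ℓ ≡ true → sumOn (remove S ℓ) h + h ℓ ≡ sumOn S h
  sumOn-remove S {ℓ} h ℓ∈S = begin
    sumOn (remove S ℓ) h + h ℓ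
      ≡⟨ cong (sumOn (remove S ℓ) h +_) (sym (∑-δ ℓ (h ℓ))) ⟩
    sumOn (remove S ℓ) h + ∑[ i < n ] (if ⌊ i ≟ ℓ ⌋ then h ℓ else 0)
      ≡⟨ sym (∑-distrib-+ {n} _ _) ⟩
    ∑[ i < n ] ((if remove S ℓ i then h i else 0) + (if ⌊ i ≟ ℓ ⌋ then h ℓ else 0))
      ≡⟨ sum-cong-≗ split ⟩
    sumOn S h ∎
    where
    open ≡-Reasoning
    split : ∀ i → (if remove S ℓ i then h i else 0) + (if ⌊ i ≟ ℓ ⌋ then h ℓ else 0) ≡ (if S i then h i else 0)
    split i with i ≟ ℓ
    ... | yes refl rewrite ℓ∈S = refl
    ... | no  _    rewrite Bool.∧-identityʳ (S i) = +-identityʳ _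

  module _ (d : Fin n → ℕ) where

    weightTerm : (Fin n → Bool) → Fin n → Fin n → ℕ
    weightTerm S i j = if S i ∧ S j ∧ r i j then d i ⊓ d j else 0

    weight : (Fin n → Bool) → ℕ
    weight S = ∑[ i < n ] ∑[ j < n ] weightTerm S i j

    module _ {S} (L : AtMostOneNeighbourIn S) where
      open AtMostOneNeighbourIn L renaming (vertex to ℓ; vertex∈S to ℓ∈S; neighbour to p; neighbour-unique to p-unique)

      δ : Fin n → Fin n → Fin n → Fin n → ℕ
      δ a b i j = if ⌊ i ≟ a ⌋ ∧ ⌊ j ≟ b ⌋ then d ℓ else 0

      δ-diag : ∀ a b → δ a b a b ≡ d ℓ
      δ-diag a b rewrite ⌊⌋-yes (a ≟ a) refl | ⌊⌋-yes (b ≟ b) refl = refl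

      weightTerm-row : ∀ j → weightTerm S ℓ j ≤ δ ℓ p ℓ j
      weightTerm-row j rewrite ℓ∈S with S j in j∈S | r ℓ j in ℓRj
      ... | false | _     = z≤n
      ... | true  | false = z≤n
      ... | true  | true with refl ← p-unique j j∈S ℓRj =
        ≤-trans (m⊓n≤m (d ℓ) (d p)) (≤-reflexive (sym (δ-diag ℓ p)))

      weightTerm-column : ∀ i → weightTerm S i ℓ ≤ δ p ℓ i ℓ
      weightTerm-column i rewrite ℓ∈S with S i in i∈S | r i ℓ in iRℓ
      ... | false | _     = z≤n
      ... | true  | false = z≤n
      ... | true  | true with refl ← p-unique i i∈S (trans (r-sym ℓ i) iRℓ) =
        ≤-trans (m⊓n≤n (d p) (d ℓ)) (≤-reflexive (sym (δ-diag p ℓ)))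

      weightTerm-remove : ∀ {i j} → i ≢ ℓ → j ≢ ℓ → weightTerm (remove S ℓ) i j ≡ weightTerm S i j
      weightTerm-remove {i} {j} i≢ℓ j≢ℓ
        rewrite ⌊⌋-no (i ≟ ℓ) i≢ℓ | ⌊⌋-no (j ≟ ℓ) j≢ℓ | Bool.∧-identityʳ (S i) | Bool.∧-identityʳ (S j) = refl

      weightTerm≤ : ∀ i j → weightTerm S i j ≤ weightTerm (remove S ℓ) i j + (δ ℓ p i j + δ p ℓ i j)
      weightTerm≤ i j = by-cases (i ≟ ℓ) (j ≟ ℓ)
        where
        by-cases : Dec (i ≡ ℓ) → Dec (j ≡ ℓ) →
                   weightTerm S i j ≤ weightTerm (remove S ℓ) i j + (δ ℓ p i j + δ p ℓ i j)
        by-cases (yes refl) _ =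
          ≤-trans (weightTerm-row j) (≤-trans (m≤m+n _ (δ p ℓ i j)) (m≤n+m _ (weightTerm (remove S ℓ) i j)))
        by-cases (no _) (yes refl) =
          ≤-trans (weightTerm-column i) (≤-trans (m≤n+m _ (δ ℓ p i j)) (m≤n+m _ (weightTerm (remove S ℓ) i j)))
        by-cases (no i≢ℓ) (no j≢ℓ) = ≤-trans (≤-reflexive (sym (weightTerm-remove i≢ℓ j≢ℓ))) (m≤m+n _ _)

      weight-remove : weight S ≤ weight (remove S ℓ) + (d ℓ + d ℓ)
      weight-remove = begin
        weight S
          ≤⟨ ∑-mono-≤ (λ i → ∑-mono-≤ (weightTerm≤ i)) ⟩
        ∑[ i < n ] ∑[ j < n ] (weightTerm (remove S ℓ) i j + (δ ℓ p i j + δ p ℓ i j))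
          ≡⟨ ∑∑-distrib-+ (weightTerm (remove S ℓ)) (λ i j → δ ℓ p i j + δ p ℓ i j) ⟩
        weight (remove S ℓ) + ∑[ i < n ] ∑[ j < n ] (δ ℓ p i j + δ p ℓ i j)
          ≡⟨ cong (weight (remove S ℓ) +_) (∑∑-distrib-+ (δ ℓ p) (δ p ℓ)) ⟩
        weight (remove S ℓ) + (∑[ i < n ] ∑[ j < n ] δ ℓ p i j + ∑[ i < n ] ∑[ j < n ] δ p ℓ i j)
          ≡⟨ cong (weight (remove S ℓ) +_) (cong₂ _+_ (∑∑-δ ℓ p (d ℓ)) (∑∑-δ p ℓ (d ℓ))) ⟩
        weight (remove S ℓ) + (d ℓ + d ℓ) ∎
        where open ≤-Reasoning

    size : (Fin n → Bool) → ℕ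
    size S = sumOn S (λ _ → 1)

    size-remove : ∀ S {ℓ} → S ℓ ≡ true → suc (size (remove S ℓ)) ≡ size S
    size-remove S ℓ∈S = trans (+-comm 1 _) (sumOn-remove S (λ _ → 1) ℓ∈S)

    edgeless⇒weight≡0 : ∀ S → (∀ i j → (S i ∧ S j ∧ r i j) ≢ true) → weight S ≡ 0
    edgeless⇒weight≡0 S edgeless =
      trans (sum-cong-≗ (λ i → trans (sum-cong-≗ (term≡0 i)) (sum-replicate-zero n))) (sum-replicate-zero n)
      where
      term≡0 : ∀ i j → weightTerm S i j ≡ 0
      term≡0 i j with S i ∧ S j ∧ r i j in edge
      ... | true  = ⊥-elim (edgeless i j edge)
      ... | false = refl

    weight≤2sumOn : ∀ fuel S → size S ≤ fuel → weight S ≤ sumOn S d + sumOn S d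
    weight≤2sumOn fuel S size≤fuel with any? (λ i → any? (λ j → (S i ∧ S j ∧ r i j) Bool.≟ true))
    ... | no noEdge = ≤-trans (≤-reflexive (edgeless⇒weight≡0 S (λ i j edge → noEdge (i , j , edge)))) z≤n
    ... | yes (i , j , edge) with L ← atMostOneNeighbour-exists S (∧-trueˡ edge) (∧-trueʳ (∧-trueʳ {S i} edge))
                             with fuel
    ...   | zero = ⊥-elim (<⇒≱ (subst (0 <_) (size-remove S ℓ∈S) (s≤s z≤n)) size≤fuel)
      where open AtMostOneNeighbourIn L renaming (vertex to ℓ; vertex∈S to ℓ∈S)
    ...   | suc fuel′ = begin
      weight S                                   ≤⟨ weight-remove L ⟩
      weight S′ + (d ℓ + d ℓ)                     ≤⟨ +-monoˡ-≤ (d ℓ + d ℓ) (weight≤2sumOn fuel′ S′ size′≤fuel′) ⟩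
      sumOn S′ d + sumOn S′ d + (d ℓ + d ℓ)       ≡⟨ +-interchange (sumOn S′ d) (sumOn S′ d) (d ℓ) (d ℓ) ⟩
      (sumOn S′ d + d ℓ) + (sumOn S′ d + d ℓ)     ≡⟨ cong₂ _+_ (sumOn-remove S d ℓ∈S) (sumOn-remove S d ℓ∈S) ⟩
      sumOn S d + sumOn S d                       ∎
      where
      open ≤-Reasoning
      open AtMostOneNeighbourIn L renaming (vertex to ℓ; vertex∈S to ℓ∈S)
      S′ = remove S ℓ
      size′≤fuel′ : size S′ ≤ fuel′
      size′≤fuel′ = ≤-pred (subst (_≤ suc fuel′) (sym (size-remove S ℓ∈S)) size≤fuel)

    forest-weight≤ : ∑[ i < n ] ∑[ j < n ] (if r i j then d i ⊓ d j else 0) ≤ sum d + sum d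
    forest-weight≤ = weight≤2sumOn n (λ _ → true) (≤-reflexive (trans (∑-const n 1) (*-identityʳ n)))

module Hybrid {n : ℕ} (G : Graph n) where
  open Graph G

  isEdge : Fin n → Fin n → Bool
  isEdge i j = ⌊ i <? j ⌋ ∧ M i j

  sumMap-edgeList : ∀ (f : Fin n × Fin n → ℕ) →
                    sumMap f (edgeList G) ≡ ∑[ i < n ] ∑[ j < n ] (if isEdge i j then f (i , j) else 0)
  sumMap-edgeList f = begin
    sumMap f (edgeList G)
      ≡⟨ sumMap-concatMap f neighboursAbove (allFin n) ⟩
    sumMap (sumMap f ∘ neighboursAbove) (allFin n)
      ≡⟨ sumMap-allFin (sumMap f ∘ neighboursAbove) ⟩
    ∑[ i < n ] sumMap f (neighboursAbove i)
      ≡⟨ sum-cong-≗ row ⟩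
    ∑[ i < n ] ∑[ j < n ] (if isEdge i j then f (i , j) else 0) ∎
    where
    open ≡-Reasoning
    neighboursAbove : Fin n → List (Fin n × Fin n)
    neighboursAbove i = map (i ,_) (filterᵇ (isEdge i) (allFin n))
    row : ∀ i → sumMap f (neighboursAbove i) ≡ ∑[ j < n ] (if isEdge i j then f (i , j) else 0)
    row i = trans (sumMap-map f (i ,_) (filterᵇ (isEdge i) (allFin n)))
                  (trans (sumMap-filterᵇ (λ j → f (i , j)) (isEdge i) (allFin n))
                         (sumMap-allFin (λ j → if isEdge i j then f (i , j) else 0)))

  numEdges≡ : numEdges G ≡ ∑[ i < n ] ∑[ j < n ] (if isEdge i j then 1 else 0)
  numEdges≡ = trans (length≡sumMap-1 (edgeList G)) (sumMap-edgeList (λ _ → 1))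

  reports : Fin n → Fin n → Fin n → List (Fin n) → List (Triple G)
  reports i j y ks = map (λ k → i , j , k) (filterᵇ (λ k → ⌊ j <? k ⌋ ∧ M y k) ks)

  innerLoop≡ : ∀ i j y ks → innerLoop G i j y ks ≡ (reports i j y ks , length ks)
  innerLoop≡ i j y []       = refl
  innerLoop≡ i j y (k ∷ ks) rewrite innerLoop≡ i j y ks with ⌊ j <? k ⌋ ∧ M y k
  ... | true  = refl
  ... | false = refl

  -- x is the endpoint whose adjacency list is scanned, y the one whose matrix row is probed
  data Scan (i j : Fin n) : Fin n → Fin n → Set where
    scan-i : deg G i ≤ deg G j → Scan i j i j
    scan-j : deg G j < deg G i → Scan i j j i

  hybridEdge-scan : ∀ i j → Σ (Fin n) λ x → Σ (Fin n) λ y →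
                    Scan i j x y × hybridEdge G (i , j) ≡ (reports i j y (ADJ x) , deg G x)
  hybridEdge-scan i j with deg G i ≤ᵇ deg G j in di≤ᵇdj
  ... | true  = i , j , scan-i (≤ᵇ⇒≤ (deg G i) (deg G j) (subst T (sym di≤ᵇdj) tt)) , innerLoop≡ i j j (ADJ i)
  ... | false = j , i , scan-j (≰⇒> (λ di≤dj → subst T di≤ᵇdj (≤⇒≤ᵇ di≤dj))) , innerLoop≡ i j i (ADJ j)

  hybridRun≡ : ∀ es → hybridRun G es ≡ (concatMap (proj₁ ∘ hybridEdge G) es , sumMap (suc ∘ proj₂ ∘ hybridEdge G) es)
  hybridRun≡ []       = refl
  hybridRun≡ (e ∷ es) rewrite hybridRun≡ es with hybridEdge G e
  ... | out , cost = refl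

module RunningTime {n : ℕ} (G : Graph n) where
  open Graph G
  open Hybrid G

  Scan⇒deg≡⊓ : ∀ {i j x y} → Scan i j x y → deg G x ≡ deg G i ⊓ deg G j
  Scan⇒deg≡⊓ (scan-i di≤dj) = sym (m≤n⇒m⊓n≡m di≤dj)
  Scan⇒deg≡⊓ (scan-j dj<di) = sym (m≥n⇒m⊓n≡n (<⇒≤ dj<di))

  hybridEdge-cost : ∀ i j → proj₂ (hybridEdge G (i , j)) ≡ deg G i ⊓ deg G j
  hybridEdge-cost i j with hybridEdge-scan i j
  ... | x , y , scan , eq = trans (cong proj₂ eq) (Scan⇒deg≡⊓ scan)

  hybridTime≡ : hybridTime G ≡ numEdges G + ∑[ i < n ] ∑[ j < n ] (if isEdge i j then deg G i ⊓ deg G j else 0)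
  hybridTime≡ = begin
    hybridTime G
      ≡⟨ cong proj₂ (hybridRun≡ (edgeList G)) ⟩
    sumMap (suc ∘ proj₂ ∘ hybridEdge G) (edgeList G)
      ≡⟨ sumMap-suc (proj₂ ∘ hybridEdge G) (edgeList G) ⟩
    numEdges G + sumMap (proj₂ ∘ hybridEdge G) (edgeList G)
      ≡⟨ cong (numEdges G +_) (sumMap-cong (λ (i , j) → hybridEdge-cost i j) (edgeList G)) ⟩
    numEdges G + sumMap (λ (i , j) → deg G i ⊓ deg G j) (edgeList G)
      ≡⟨ cong (numEdges G +_) (sumMap-edgeList (λ (i , j) → deg G i ⊓ deg G j)) ⟩
    numEdges G + ∑[ i < n ] ∑[ j < n ] (if isEdge i j then deg G i ⊓ deg G j else 0) ∎
    where open ≡-Reasoning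

  occ-ADJ : ∀ v w → occ w (ADJ v) ≡ (if M v w then 1 else 0)
  occ-ADJ v w with M v w in vw
  ... | true  = Unique∧∈⇒occ≡1 (ADJ v) (ADJ-unique v) (Equivalence.from (ADJ-correct v w) vw)
  ... | false = ∉⇒occ≡0 (ADJ v) λ w∈ADJ → case trans (sym vw) (Equivalence.to (ADJ-correct v w) w∈ADJ) of λ ()

  M≡isEdge+isEdge : ∀ v w → (if M v w then 1 else 0) ≡ (if isEdge v w then 1 else 0) + (if isEdge w v then 1 else 0)
  M≡isEdge+isEdge v w with <-cmp v w
  ... | tri< v<w _ w≮v rewrite ⌊⌋-yes (v <? w) v<w | ⌊⌋-no (w <? v) w≮v = sym (+-identityʳ _)
  ... | tri> v≮w _ w<v rewrite ⌊⌋-no (v <? w) v≮w | ⌊⌋-yes (w <? v) w<v | M-sym v w = refl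
  ... | tri≈ _ refl _  rewrite M-irrefl v | ⌊⌋-no (v <? v) (<-irrefl refl) = refl

  handshake : sum (deg G) ≡ numEdges G + numEdges G
  handshake = begin
    ∑[ v < n ] deg G v
      ≡⟨ sum-cong-≗ (λ v → trans (length≡∑occ (ADJ v)) (sum-cong-≗ (occ-ADJ v))) ⟩
    ∑[ v < n ] ∑[ w < n ] (if M v w then 1 else 0)
      ≡⟨ sum-cong-≗ (λ v → sum-cong-≗ (M≡isEdge+isEdge v)) ⟩
    ∑[ v < n ] ∑[ w < n ] ((if isEdge v w then 1 else 0) + (if isEdge w v then 1 else 0))
      ≡⟨ ∑∑-distrib-+ (λ v w → if isEdge v w then 1 else 0) (λ v w → if isEdge w v then 1 else 0) ⟩
    ∑[ v < n ] ∑[ w < n ] (if isEdge v w then 1 else 0) + ∑[ v < n ] ∑[ w < n ] (if isEdge w v then 1 else 0)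
      ≡⟨ cong (∑[ v < n ] ∑[ w < n ] (if isEdge v w then 1 else 0) +_) (∑-comm (λ v w → if isEdge w v then 1 else 0)) ⟩
    ∑[ v < n ] ∑[ w < n ] (if isEdge v w then 1 else 0) + ∑[ w < n ] ∑[ v < n ] (if isEdge w v then 1 else 0)
      ≡⟨ cong₂ _+_ numEdges≡ numEdges≡ ⟨
    numEdges G + numEdges G ∎
    where open ≡-Reasoning

  module _ {α} (col : Fin n → Fin n → Fin α) (col-sym : ∀ u v → col u v ≡ col v u)
           (col-acyclic : ∀ c → Acyclic G (λ u v → Adj G u v × col u v ≡ c)) where

    colourClass : Fin α → Fin n → Fin n → Bool
    colourClass c u v = M u v ∧ ⌊ c ≟ col u v ⌋

    colourClass-forest : ∀ c → ∑[ i < n ] ∑[ j < n ] (if colourClass c i j then deg G i ⊓ deg G j else 0)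
                               ≤ sum (deg G) + sum (deg G)
    colourClass-forest c = Forest.forest-weight≤ G (colourClass c) symmetric irreflexive acyclic (deg G)
      where
      symmetric : ∀ u v → colourClass c u v ≡ colourClass c v u
      symmetric u v rewrite M-sym u v | col-sym u v = refl
      irreflexive : ∀ v → colourClass c v v ≡ false
      irreflexive v rewrite M-irrefl v = refl
      acyclic : Acyclic G (λ u v → colourClass c u v ≡ true)
      acyclic = Acyclic-antimono G (λ {u} {v} uv → ∧-trueˡ uv , sym (⌊⌋-sound (c ≟ col u v) (∧-trueʳ {M u v} uv)))
                                 (col-acyclic c)

    M≡∑colourClass : ∀ i j (w : ℕ) → (if M i j then w else 0) ≡ ∑[ c < α ] (if colourClass c i j then w else 0)
    M≡∑colourClass i j w with M i j
    ... | true  = sym (∑-δ (col i j) w)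
    ... | false = sym (sum-replicate-zero α)

    edgeCost≤ : ∑[ i < n ] ∑[ j < n ] (if isEdge i j then deg G i ⊓ deg G j else 0) ≤ α * (sum (deg G) + sum (deg G))
    edgeCost≤ = begin
      ∑[ i < n ] ∑[ j < n ] (if isEdge i j then w i j else 0)
        ≤⟨ ∑-mono-≤ (λ i → ∑-mono-≤ (λ j → isEdge≤M i j)) ⟩
      ∑[ i < n ] ∑[ j < n ] (if M i j then w i j else 0)
        ≡⟨ sum-cong-≗ (λ i → sum-cong-≗ (λ j → M≡∑colourClass i j (w i j))) ⟩
      ∑[ i < n ] ∑[ j < n ] ∑[ c < α ] (if colourClass c i j then w i j else 0)
        ≡⟨ sum-cong-≗ (λ i → ∑-comm {n} {α} (λ j c → if colourClass c i j then w i j else 0)) ⟩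
      ∑[ i < n ] ∑[ c < α ] ∑[ j < n ] (if colourClass c i j then w i j else 0)
        ≡⟨ ∑-comm {n} {α} (λ i c → ∑[ j < n ] (if colourClass c i j then w i j else 0)) ⟩
      ∑[ c < α ] ∑[ i < n ] ∑[ j < n ] (if colourClass c i j then w i j else 0)
        ≤⟨ ∑-mono-≤ colourClass-forest ⟩
      ∑[ c < α ] (sum (deg G) + sum (deg G))
        ≡⟨ ∑-const α _ ⟩
      α * (sum (deg G) + sum (deg G)) ∎
      where
      open ≤-Reasoning
      w : Fin n → Fin n → ℕ
      w i j = deg G i ⊓ deg G j
      isEdge≤M : ∀ i j → (if isEdge i j then w i j else 0) ≤ (if M i j then w i j else 0)
      isEdge≤M i j with ⌊ i <? j ⌋
      ... | true  = ≤-refl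
      ... | false = z≤n

  numEdges≤numEdges*α : ∀ {α} → ForestPartition G α → numEdges G ≤ numEdges G * α
  numEdges≤numEdges*α {suc α} _               = m≤m*n (numEdges G) (suc α)
  numEdges≤numEdges*α {zero}  (col , _ , _) = subst (_≤ numEdges G * 0) (sym noEdges) z≤n
    where
    noEdges : numEdges G ≡ 0
    noEdges = trans numEdges≡ (trans (sum-cong-≗ (λ i → ⊥-elim (¬Fin0 (col i i)))) (sum-replicate-zero n))

  hybridTime≤ : ∀ {α} → ForestPartition G α → hybridTime G ≤ 5 * numEdges G * α
  hybridTime≤ {α} F@(col , col-sym , col-acyclic) = begin
    hybridTime G
      ≡⟨ hybridTime≡ ⟩
    m + ∑[ i < n ] ∑[ j < n ] (if isEdge i j then deg G i ⊓ deg G j else 0)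
      ≤⟨ +-monoʳ-≤ m (edgeCost≤ col col-sym col-acyclic) ⟩
    m + α * (sum (deg G) + sum (deg G))
      ≡⟨ cong (λ s → m + α * (s + s)) handshake ⟩
    m + α * ((m + m) + (m + m))
      ≤⟨ +-monoˡ-≤ _ (numEdges≤numEdges*α F) ⟩
    m * α + α * ((m + m) + (m + m))
      ≡⟨ arithmetic m α ⟩
    5 * m * α ∎
    where
    open ≤-Reasoning
    m = numEdges G
    arithmetic : ∀ m α → m * α + α * ((m + m) + (m + m)) ≡ 5 * m * α
    arithmetic = solve-∀


module Correctness {n : ℕ} (G : Graph n) where
  open Graph G
  open Hybrid G

  Scan⇒triangle : ∀ {i j x y k} → Scan i j x y → Adj G i j → Adj G y k → Adj G x k → IsTriangle G i j k
  Scan⇒triangle (scan-i _) ij jk ik = ij , ik , jk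
  Scan⇒triangle (scan-j _) ij ik jk = ij , ik , jk

  IsReportedTriangle : Triple G → Set
  IsReportedTriangle (x , y , z) = IsTriangle G x y z

  reports-sound : ∀ {i j x y} → Scan i j x y → Adj G i j → All IsReportedTriangle (reports i j y (ADJ x))
  reports-sound {i} {j} {x} {y} scan ij =
    map⁺ (All.map triangle (All.zip (all-filter (T? ∘ probe) (ADJ x) , filter⁺ (T? ∘ probe) adjacent)))
    where
    probe : Fin n → Bool
    probe k = ⌊ j <? k ⌋ ∧ M y k
    adjacent : All (Adj G x) (ADJ x)
    adjacent = All.tabulate (λ {k} → Equivalence.to (ADJ-correct x k))
    triangle : ∀ {k} → T (probe k) × Adj G x k → IsTriangle G i j k
    triangle (j<k∧yk , xk) = Scan⇒triangle scan ij (Equivalence.to T-≡ (proj₂ (Equivalence.to T-∧ j<k∧yk))) xk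

  edgeList-edges : All (λ (i , j) → T (isEdge i j)) (edgeList G)
  edgeList-edges = concat⁺ (map⁺ (All.universal (λ i → map⁺ (all-filter (T? ∘ isEdge i) (allFin n))) (allFin n)))

  hybridOutput-sound : All IsReportedTriangle (hybridOutput G)
  hybridOutput-sound =
    subst (All IsReportedTriangle) (sym (cong proj₁ (hybridRun≡ (edgeList G))))
          (concat⁺ (map⁺ (All.map (λ {(i , j)} → edge-sound i j) edgeList-edges)))
    where
    edge-sound : ∀ i j → T (isEdge i j) → All IsReportedTriangle (proj₁ (hybridEdge G (i , j)))
    edge-sound i j i<j∧ij with hybridEdge-scan i j
    ... | x , y , scan , eq rewrite eq =
      reports-sound scan (Equivalence.to T-≡ (proj₂ (Equivalence.to T-∧ i<j∧ij)))

  _∈₃_ : Fin n → Triple G → Set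
  v ∈₃ (x , y , z) = v ≡ x ⊎ v ≡ y ⊎ v ≡ z

  memb-sound : ∀ v t → memb G v t ≡ true → v ∈₃ t
  memb-sound v (x , y , z) v∈t with v ≟ x | v ≟ y | v ≟ z
  ... | yes v≡x | _       | _       = inj₁ v≡x
  ... | no _    | yes v≡y | _       = inj₂ (inj₁ v≡y)
  ... | no _    | no _    | yes v≡z = inj₂ (inj₂ v≡z)

  memb-complete : ∀ v t → v ∈₃ t → memb G v t ≡ true
  memb-complete v (x , y , z) (inj₁ refl)        rewrite ⌊⌋-yes (v ≟ v) refl = refl
  memb-complete v (x , y , z) (inj₂ (inj₁ refl)) rewrite ⌊⌋-yes (v ≟ v) refl = Bool.∨-zeroʳ _
  memb-complete v (x , y , z) (inj₂ (inj₂ refl)) rewrite ⌊⌋-yes (v ≟ v) refl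
    = trans (cong (⌊ v ≟ x ⌋ ∨_) (Bool.∨-zeroʳ _)) (Bool.∨-zeroʳ _)

  Sorted : Triple G → Set
  Sorted (x , y , z) = x <ᶠ y × y <ᶠ z

  sorted-lower : ∀ {x y z} → Sorted (x , y , z) → ∀ {v} → v ∈₃ (x , y , z) → toℕ x ≤ toℕ v
  sorted-lower _         (inj₁ refl)        = ≤-refl
  sorted-lower (x<y , _) (inj₂ (inj₁ refl)) = <⇒≤ x<y
  sorted-lower (x<y , y<z) (inj₂ (inj₂ refl)) = <⇒≤ (<-trans x<y y<z)

  sorted-upper : ∀ {x y z} → Sorted (x , y , z) → ∀ {v} → v ∈₃ (x , y , z) → toℕ v ≤ toℕ z
  sorted-upper (x<y , y<z) (inj₁ refl)        = <⇒≤ (<-trans x<y y<z)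
  sorted-upper (_ , y<z)   (inj₂ (inj₁ refl)) = <⇒≤ y<z
  sorted-upper _           (inj₂ (inj₂ refl)) = ≤-refl

  sorted-unique : ∀ {s t} → Sorted s → Sorted t → (∀ {v} → v ∈₃ s → v ∈₃ t) → (∀ {v} → v ∈₃ t → v ∈₃ s) → s ≡ t
  sorted-unique {a , b , c} {x , y , z} s↑@(a<b , b<c) t↑ s⊆t t⊆s = cong₂ _,_ a≡x (cong₂ _,_ b≡y c≡z)
    where
    a≡x : a ≡ x
    a≡x = toℕ-injective (≤-antisym (sorted-lower s↑ (t⊆s (inj₁ refl))) (sorted-lower t↑ (s⊆t (inj₁ refl))))
    c≡z : c ≡ z
    c≡z = toℕ-injective (≤-antisym (sorted-upper t↑ (s⊆t (inj₂ (inj₂ refl)))) (sorted-upper s↑ (t⊆s (inj₂ (inj₂ refl)))))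
    b≡y : b ≡ y
    b≡y with s⊆t (inj₂ (inj₁ refl))
    ... | inj₁ refl        = ⊥-elim (<-irrefl a≡x a<b)
    ... | inj₂ (inj₁ b≡y)  = b≡y
    ... | inj₂ (inj₂ refl) = ⊥-elim (<-irrefl (sym c≡z) b<c)

  Scan⇒adjacent : ∀ {i j x y k} → Scan i j x y → Adj G i k → Adj G j k → Adj G x k × Adj G y k
  Scan⇒adjacent (scan-i _) ik jk = ik , jk
  Scan⇒adjacent (scan-j _) ik jk = jk , ik

  module _ {a b c : Fin n} (a<b : a <ᶠ b) (b<c : b <ᶠ c) (abc : IsTriangle G a b c) where

    matches : Triple G → ℕ
    matches t = if sameSet G a b c t then 1 else 0

    matches-self : matches (a , b , c) ≡ 1
    matches-self rewrite memb-complete a (a , b , c) (inj₁ refl)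
                       | memb-complete b (a , b , c) (inj₂ (inj₁ refl))
                       | memb-complete c (a , b , c) (inj₂ (inj₂ refl)) = refl

    sameSet-sound : ∀ {t} → Sorted t → sameSet G a b c t ≡ true → t ≡ (a , b , c)
    sameSet-sound {t@(x , y , z)} t↑ same with ∧-true⁶ {memb G a t} same
    ... | a∈t , b∈t , c∈t , x∈abc , y∈abc , z∈abc = sorted-unique t↑ (a<b , b<c) t⊆abc abc⊆t
      where
      abc⊆t : ∀ {v} → v ∈₃ (a , b , c) → v ∈₃ t
      abc⊆t (inj₁ refl)        = memb-sound a t a∈t
      abc⊆t (inj₂ (inj₁ refl)) = memb-sound b t b∈t
      abc⊆t (inj₂ (inj₂ refl)) = memb-sound c t c∈t
      t⊆abc : ∀ {v} → v ∈₃ t → v ∈₃ (a , b , c)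
      t⊆abc (inj₁ refl)        = memb-sound x (a , b , c) x∈abc
      t⊆abc (inj₂ (inj₁ refl)) = memb-sound y (a , b , c) y∈abc
      t⊆abc (inj₂ (inj₂ refl)) = memb-sound z (a , b , c) z∈abc

    matches-other : ∀ {t} → Sorted t → t ≢ (a , b , c) → matches t ≡ 0
    matches-other {t} t↑ t≢abc with sameSet G a b c t in same
    ... | true  = ⊥-elim (t≢abc (sameSet-sound t↑ same))
    ... | false = refl

    reports-miss : ∀ {i j} y ks → i <ᶠ j → ¬ (i ≡ a × j ≡ b) → sumMap matches (reports i j y ks) ≡ 0
    reports-miss         y []       _   _     = refl
    reports-miss {i} {j} y (k ∷ ks) i<j ij≢ab with ⌊ j <? k ⌋ ∧ M y k in probe
    ... | false = reports-miss y ks i<j ij≢ab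
    ... | true  = cong₂ _+_ (matches-other (i<j , ⌊⌋-sound (j <? k) (∧-trueˡ probe)) λ { refl → ij≢ab (refl , refl) })
                            (reports-miss y ks i<j ij≢ab)

    reports-hit : ∀ y ks → Adj G y c → sumMap matches (reports a b y ks) ≡ occ c ks
    reports-hit y []       _  = refl
    reports-hit y (k ∷ ks) yc with c ≟ k
    ... | yes refl rewrite ⌊⌋-yes (b <? c) b<c | yc = cong₂ _+_ matches-self (reports-hit y ks yc)
    ... | no c≢k with ⌊ b <? k ⌋ ∧ M y k in probe
    ...   | false = reports-hit y ks yc
    ...   | true  = cong₂ _+_ (matches-other (a<b , ⌊⌋-sound (b <? k) (∧-trueˡ probe)) λ { refl → c≢k refl })
                              (reports-hit y ks yc)

    edge-matches : ∀ i j → (if isEdge i j then sumMap matches (proj₁ (hybridEdge G (i , j))) else 0)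
                           ≡ (if ⌊ i ≟ a ⌋ ∧ ⌊ j ≟ b ⌋ then 1 else 0)
    edge-matches i j with isEdge i j in ij
    edge-matches i j | false with i ≟ a | j ≟ b
    ... | yes refl | yes refl rewrite ⌊⌋-yes (a <? b) a<b | proj₁ abc with () ← ij
    ... | yes _    | no _     = refl
    ... | no _     | _        = refl
    edge-matches i j | true with hybridEdge-scan i j
    ... | x , y , scan , eq rewrite eq with i ≟ a | j ≟ b
    ...   | yes refl | yes refl =
            trans (reports-hit y (ADJ x) y∼c)
                  (Unique∧∈⇒occ≡1 (ADJ x) (ADJ-unique x) (Equivalence.from (ADJ-correct x c) x∼c))
            where
            x∼c = proj₁ (Scan⇒adjacent scan (proj₁ (proj₂ abc)) (proj₂ (proj₂ abc)))
            y∼c = proj₂ (Scan⇒adjacent scan (proj₁ (proj₂ abc)) (proj₂ (proj₂ abc)))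
    ...   | yes _    | no j≢b  = reports-miss y (ADJ x) (⌊⌋-sound (i <? j) (∧-trueˡ ij)) (j≢b ∘ proj₂)
    ...   | no i≢a   | _       = reports-miss y (ADJ x) (⌊⌋-sound (i <? j) (∧-trueˡ ij)) (i≢a ∘ proj₁)

    timesReported≡1 : timesReported G a b c ≡ 1
    timesReported≡1 = begin
      length (filterᵇ (sameSet G a b c) (hybridOutput G))
        ≡⟨ length≡sumMap-1 (filterᵇ (sameSet G a b c) (hybridOutput G)) ⟩
      sumMap (λ _ → 1) (filterᵇ (sameSet G a b c) (hybridOutput G))
        ≡⟨ sumMap-filterᵇ (λ _ → 1) (sameSet G a b c) (hybridOutput G) ⟩
      sumMap matches (hybridOutput G)
        ≡⟨ cong (sumMap matches ∘ proj₁) (hybridRun≡ (edgeList G)) ⟩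
      sumMap matches (concatMap (proj₁ ∘ hybridEdge G) (edgeList G))
        ≡⟨ sumMap-concatMap matches (proj₁ ∘ hybridEdge G) (edgeList G) ⟩
      sumMap (sumMap matches ∘ proj₁ ∘ hybridEdge G) (edgeList G)
        ≡⟨ sumMap-edgeList (sumMap matches ∘ proj₁ ∘ hybridEdge G) ⟩
      ∑[ i < n ] ∑[ j < n ] (if isEdge i j then sumMap matches (proj₁ (hybridEdge G (i , j))) else 0)
        ≡⟨ sum-cong-≗ (λ i → sum-cong-≗ (edge-matches i)) ⟩
      ∑[ i < n ] ∑[ j < n ] (if ⌊ i ≟ a ⌋ ∧ ⌊ j ≟ b ⌋ then 1 else 0)
        ≡⟨ ∑∑-δ a b 1 ⟩
      1 ∎
      where open ≡-Reasoning

mainTheorem4 :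
    -- correctness: only triangles are reported, and each triangle exactly once
    (∀ {n} (G : Graph n) →
       All (λ { (x , y , z) → IsTriangle G x y z }) (hybridOutput G) ×
       (∀ a b c → a Data.Fin.< b → b Data.Fin.< c → IsTriangle G a b c →
          timesReported G a b c ≡ 1))
    ×
    -- running time O(m α)
    (∃ λ (C : ℕ) → ∀ {n} (G : Graph n) (α : ℕ) → IsArboricity G α →
       hybridTime G ≤ C * numEdges G * α)
mainTheorem4 =
    (λ G → Correctness.hybridOutput-sound G , λ a b c a<b b<c abc → Correctness.timesReported≡1 G a<b b<c abc)
  , (5 , λ G α (partition , _) → RunningTime.hybridTime≤ G partition)
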